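{- For every positive integer $k$, $\alpha(k)\leq bl(k)+1$.
   Context: For a finite family $\mathcal{S}=\{S_1,\dots,S_r\}$ of finite sets, $\mathbf{ID}(\mathcal{S})=2^{S_1}\cup\cdots\cup 2^{S_r}$ (all sets contained in some member of $\mathcal{S}$). For a positive integer $k$, $\alpha(k)$ is the minimum of $|\mathcal{S}|$ over all finite families $\mathcal{S}$ of finite sets with $|\mathbf{ID}(\mathcal{S})|=k$. The block count $bl(k)$ of a positive integer $k$ is the number $b$ in the unique representation of the binary expansion of $k$ as $\mathbf{1}_{q_b}\mathbf{0}_{l_b}\cdots\mathbf{1}_{q_2}\mathbf{0}_{l_2}\mathbf{1}_{q_1}\mathbf{0}_{l_1}$ with $q_i>0$ ($i\in[b]$), $l_j>0$ ($j\in[2,b]$), $l_1\geq 0$, where $\mathbf{1}_q$, $\mathbf{0}_l$ denote strings of $q$ ones and $l$ zeros; i.e. the number of maximal runs of consecutive 1's. -}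

module Defs where

open import Data.Nat using (ℕ; zero; suc; _+_; _^_; _/_; _%_)
open import Data.Nat.Properties using (_≟_)
open import Data.Bool using (Bool; true; false)
open import Data.Vec using (Vec; []; _∷_)
open import Data.List using (List; []; _∷_; length; filter; map; _++_; upTo; sum)
open import Data.List.Relation.Unary.Any using (any?)
open import Data.Fin.Subset using (Subset; _⊆_; inside; outside)
open import Data.Fin.Subset.Properties using (_⊆?_)
open import Relation.Nullary using (Dec; yes; no)
open import Relation.Nullary.Decidable using (_×-dec_; ¬?)

allSubsets : (n : ℕ) → List (Subset n)
allSubsets zero = [] ∷ []
allSubsets (suc n) =
  map (outside ∷_) (allSubsets n) ++ map (inside ∷_) (allSubsets n)

Family : ℕ → Set
Family n = List (Subset n)

InID : {n : ℕ} → Family n → Subset n → Set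
InID 𝒮 T = Data.List.Relation.Unary.Any.Any (λ S → T ⊆ S) 𝒮

InID? : {n : ℕ} (𝒮 : Family n) (T : Subset n) → Dec (InID 𝒮 T)
InID? 𝒮 T = any? (λ S → T ⊆? S) 𝒮

-- |ID(S)| : number of subsets of the ground set lying below some member of S.
-- (ID(S) only contains subsets of ⋃S ⊆ Fin n, so counting inside Fin n is exact.)
cardID : {n : ℕ} → Family n → ℕ
cardID {n} 𝒮 = length (filter (InID? 𝒮) (allSubsets n))

bit : ℕ → ℕ → ℕ
bit k zero = k % 2
bit k (suc i) = bit (k / 2) i

-- bl(k): number of maximal runs of 1's in the binary expansion of k,
-- i.e. the number of positions i with bit i = 1 and bit (i+1) = 0.
-- For k ≥ 1 all nonzero bits have index < k, so ranging over i < k suffices.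
topOfRun? : ℕ → ℕ → Bool
topOfRun? k i with bit k i ≟ 1 | bit k (suc i) ≟ 0
... | yes _ | yes _ = true
... | _     | _     = false

countTrue : List Bool → ℕ
countTrue [] = 0
countTrue (true ∷ bs) = suc (countTrue bs)
countTrue (false ∷ bs) = countTrue bs

bl : ℕ → ℕ
bl k = countTrue (map (topOfRun? k) (upTo k))

-- Build the family along the binary expansion of k, from the top bit down.  Adding a
-- new point to every member doubles |ID 𝒮|.  If the family is A ∷ 𝒯 with A disjoint from
-- every member of 𝒯, adding one new point to A and another to every member of 𝒯 turns
-- |ID| = k into 2k + 1 and keeps A disjoint from the rest.  When k is even, ∅ is first
-- made the distinguished set and the old family the rest: this costs one set, exactly
-- when a new run of 1's begins.  All counting reduces to splitting ID 𝒮 at one point.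
module Submission where

open import Defs
open import Data.Bool using (true; false; if_then_else_)
open import Data.Fin.Subset using (Subset; _⊆_; inside; outside; ⊥)
open import Data.Fin.Subset.Properties using (drop-∷-⊆; out⊆; in⊆in; ⊆-trans; ⊥⊆)
open import Data.List using ([]; _∷_; _++_; length; filter; map; applyUpTo; upTo)
open import Data.List.Properties using (length-++; filter-++; filter-≐; filter-none; length-map; map-upTo; map-∘; map-id)
open import Data.List.Relation.Unary.All using (universal)
open import Data.List.Relation.Unary.Any using (here; there)
open import Data.Nat using (ℕ; zero; suc; _+_; _*_; _≤_; _<_; z≤n; s≤s; s≤s⁻¹; _/_; _%_)
open import Data.Nat.Binary as Bin using (ℕᵇ; 2[1+_]; 1+[2_])
open import Data.Nat.Binary.Properties using (toℕ-fromℕ)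
open import Data.Nat.DivMod using (m%n<n; m*n%n≡0; m*n/n≡m; [m+kn]%n≡m%n; +-distrib-/; m/n<m)
open import Data.Nat.Properties using (_≟_; +-identityʳ; ≤-trans; ≤-reflexive; +-comm; +-assoc; *-comm; *-suc; *-distribˡ-+)
open import Data.Nat.Tactic.RingSolver using (solve-∀)
open import Data.Product using (Σ; _×_; _,_; proj₁; proj₂)
open import Data.Sum using (_⊎_; inj₁; inj₂)
open import Data.Vec using ([]; _∷_; tail)
open import Function using (_∘_)
open import Level using (Level)
open import Relation.Nullary using (yes; no; contradiction)
open import Relation.Unary using (Pred; Decidable; _≐_)
open import Relation.Binary.PropositionalEquality using (_≡_; refl; sym; trans; cong; cong₂; subst; module ≡-Reasoning)

private
  variable
    a b p q : Level
    A B : Set a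
    n : ℕ

length-filter-map : {P : Pred B p} {Q : Pred A q} (P? : Decidable P) (Q? : Decidable Q) {f : A → B} →
                    (P ∘ f) ≐ Q → ∀ xs → length (filter P? (map f xs)) ≡ length (filter Q? xs)
length-filter-map P? Q? Pf≐Q [] = refl
length-filter-map P? Q? {f} Pf≐Q (x ∷ xs) with P? (f x) | Q? x
... | yes _   | yes _  = cong suc (length-filter-map P? Q? Pf≐Q xs)
... | no _    | no _   = length-filter-map P? Q? Pf≐Q xs
... | yes Pfx | no ¬Qx = contradiction (proj₁ Pf≐Q Pfx) ¬Qx
... | no ¬Pfx | yes Qx = contradiction (proj₂ Pf≐Q Qx) ¬Pfx

cardID-≐ : {𝒮 𝒯 : Family n} → InID 𝒮 ≐ InID 𝒯 → cardID 𝒮 ≡ cardID 𝒯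
cardID-≐ {n} {𝒮} {𝒯} ID≐ = cong length (filter-≐ (InID? 𝒮) (InID? 𝒯) ID≐ (allSubsets n))

cardID-[] : cardID {n} [] ≡ 0
cardID-[] {n} = cong length (filter-none (InID? []) (universal (λ _ ()) (allSubsets n)))

cardID-redundant : {S S′ : Subset n} (𝒮 : Family n) → S ⊆ S′ → cardID (S ∷ S′ ∷ 𝒮) ≡ cardID (S′ ∷ 𝒮)
cardID-redundant {S = S} {S′} 𝒮 S⊆S′ = cardID-≐ (drop , there)
  where
  drop : ∀ {T} → InID (S ∷ S′ ∷ 𝒮) T → InID (S′ ∷ 𝒮) T
  drop (here T⊆S) = here (⊆-trans T⊆S S⊆S′)
  drop (there T∈ID) = T∈ID

-- ID (deletion 𝒮) and ID (link 𝒮) are the deletion and the link of the vertex 0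
-- in the simplicial complex ID 𝒮.
deletion : Family (suc n) → Family n
deletion = map tail

link : Family (suc n) → Family n
link [] = []
link ((inside ∷ S) ∷ 𝒮) = S ∷ link 𝒮
link ((outside ∷ S) ∷ 𝒮) = link 𝒮

InID-outside : (𝒮 : Family (suc n)) → (InID 𝒮 ∘ (outside ∷_)) ≐ InID (deletion 𝒮)
InID-outside 𝒮 = to 𝒮 , from 𝒮
  where
  to : ∀ 𝒮 {T} → InID 𝒮 (outside ∷ T) → InID (deletion 𝒮) T
  to ((_ ∷ _) ∷ _) (here T⊆S) = here (drop-∷-⊆ T⊆S)
  to (_ ∷ 𝒮) (there T∈ID) = there (to 𝒮 T∈ID)
  from : ∀ 𝒮 {T} → InID (deletion 𝒮) T → InID 𝒮 (outside ∷ T)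
  from ((_ ∷ _) ∷ _) (here T⊆S) = here (out⊆ T⊆S)
  from (_ ∷ 𝒮) (there T∈ID) = there (from 𝒮 T∈ID)

InID-inside : (𝒮 : Family (suc n)) → (InID 𝒮 ∘ (inside ∷_)) ≐ InID (link 𝒮)
InID-inside 𝒮 = to 𝒮 , from 𝒮
  where
  to : ∀ 𝒮 {T} → InID 𝒮 (inside ∷ T) → InID (link 𝒮) T
  to ((inside ∷ _) ∷ _) (here T⊆S) = here (drop-∷-⊆ T⊆S)
  to ((outside ∷ _) ∷ _) (here T⊆S) with () ← T⊆S Data.Vec.here
  to ((inside ∷ _) ∷ 𝒮) (there T∈ID) = there (to 𝒮 T∈ID)
  to ((outside ∷ _) ∷ 𝒮) (there T∈ID) = to 𝒮 T∈ID
  from : ∀ 𝒮 {T} → InID (link 𝒮) T → InID 𝒮 (inside ∷ T)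
  from ((inside ∷ _) ∷ _) (here T⊆S) = here (in⊆in T⊆S)
  from ((inside ∷ _) ∷ 𝒮) (there T∈ID) = there (from 𝒮 T∈ID)
  from ((outside ∷ _) ∷ 𝒮) T∈ID = there (from 𝒮 T∈ID)

cardID-deletion-link : (𝒮 : Family (suc n)) → cardID 𝒮 ≡ cardID (deletion 𝒮) + cardID (link 𝒮)
cardID-deletion-link {n} 𝒮 = begin
  length (filter ID? (avoiding0 ++ containing0))
    ≡⟨ cong length (filter-++ ID? avoiding0 containing0) ⟩
  length (filter ID? avoiding0 ++ filter ID? containing0)
    ≡⟨ length-++ (filter ID? avoiding0) ⟩
  length (filter ID? avoiding0) + length (filter ID? containing0)
    ≡⟨ cong₂ _+_ (length-filter-map ID? (InID? (deletion 𝒮)) (InID-outside 𝒮) (allSubsets n))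
                 (length-filter-map ID? (InID? (link 𝒮)) (InID-inside 𝒮) (allSubsets n)) ⟩
  cardID (deletion 𝒮) + cardID (link 𝒮)  ∎
  where
  open ≡-Reasoning
  ID? = InID? 𝒮
  avoiding0 = map (outside ∷_) (allSubsets n)
  containing0 = map (inside ∷_) (allSubsets n)

deletion-map-∷ : ∀ x (𝒮 : Family n) → deletion (map (x ∷_) 𝒮) ≡ 𝒮
deletion-map-∷ x 𝒮 = trans (sym (map-∘ 𝒮)) (map-id 𝒮)

link-map-inside : (𝒮 : Family n) → link (map (inside ∷_) 𝒮) ≡ 𝒮
link-map-inside [] = refl
link-map-inside (S ∷ 𝒮) = cong (S ∷_) (link-map-inside 𝒮)

link-map-outside : (𝒮 : Family n) → link (map (outside ∷_) 𝒮) ≡ []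
link-map-outside [] = refl
link-map-outside (S ∷ 𝒮) = link-map-outside 𝒮

cardID-cone : (𝒮 : Family n) → cardID (map (inside ∷_) 𝒮) ≡ 2 * cardID 𝒮
cardID-cone 𝒮 = begin
  cardID (map (inside ∷_) 𝒮)                                           ≡⟨ cardID-deletion-link (map (inside ∷_) 𝒮) ⟩
  cardID (deletion (map (inside ∷_) 𝒮)) + cardID (link (map (inside ∷_) 𝒮))
    ≡⟨ cong₂ (λ 𝒯 𝒰 → cardID 𝒯 + cardID 𝒰) (deletion-map-∷ inside 𝒮) (link-map-inside 𝒮) ⟩
  cardID 𝒮 + cardID 𝒮                                                  ≡⟨ m+m≡2*m (cardID 𝒮) ⟩
  2 * cardID 𝒮                                                         ∎
  where
  open ≡-Reasoning
  m+m≡2*m : ∀ m → m + m ≡ 2 * m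
  m+m≡2*m = solve-∀

cardID-map-outside : (𝒮 : Family n) → cardID (map (outside ∷_) 𝒮) ≡ cardID 𝒮
cardID-map-outside {n} 𝒮 = begin
  cardID (map (outside ∷_) 𝒮)                                             ≡⟨ cardID-deletion-link (map (outside ∷_) 𝒮) ⟩
  cardID (deletion (map (outside ∷_) 𝒮)) + cardID (link (map (outside ∷_) 𝒮))
    ≡⟨ cong₂ (λ 𝒯 𝒰 → cardID 𝒯 + cardID 𝒰) (deletion-map-∷ outside 𝒮) (link-map-outside 𝒮) ⟩
  cardID 𝒮 + cardID {n} []                                                 ≡⟨ cong (cardID 𝒮 +_) (cardID-[] {n}) ⟩
  cardID 𝒮 + 0                                                             ≡⟨ +-identityʳ _ ⟩
  cardID 𝒮                                                                 ∎
  where open ≡-Reasoning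

cardID-outside∷map-inside : (S : Subset n) (𝒮 : Family n) →
                            cardID ((outside ∷ S) ∷ map (inside ∷_) 𝒮) ≡ cardID (S ∷ 𝒮) + cardID 𝒮
cardID-outside∷map-inside S 𝒮 =
  trans (cardID-deletion-link ((outside ∷ S) ∷ map (inside ∷_) 𝒮))
        (cong₂ (λ 𝒯 𝒰 → cardID (S ∷ 𝒯) + cardID 𝒰) (deletion-map-∷ inside 𝒮) (link-map-inside 𝒮))

cardID-inside∷map-outside : (S : Subset n) (𝒮 : Family n) →
                            cardID ((inside ∷ S) ∷ map (outside ∷_) 𝒮) ≡ cardID (S ∷ 𝒮) + cardID (S ∷ [])
cardID-inside∷map-outside S 𝒮 =
  trans (cardID-deletion-link ((inside ∷ S) ∷ map (outside ∷_) 𝒮))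
        (cong₂ (λ 𝒯 𝒰 → cardID (S ∷ 𝒯) + cardID (S ∷ 𝒰)) (deletion-map-∷ outside 𝒮) (link-map-outside 𝒮))

cardID-⊥ : cardID {n} (⊥ ∷ []) ≡ 1
cardID-⊥ {zero} = refl
cardID-⊥ {suc n} = begin
  cardID {suc n} (⊥ ∷ [])                     ≡⟨ cardID-deletion-link {n} (⊥ ∷ []) ⟩
  cardID {n} (⊥ ∷ []) + cardID {n} []         ≡⟨ cong₂ _+_ (cardID-⊥ {n}) (cardID-[] {n}) ⟩
  1                                           ∎
  where open ≡-Reasoning

-- Since ID (S ∷ 𝒮) = ID 𝒮 ∪ 2^S, this says that the two parts share only ∅,
-- i.e. S is disjoint from every member of 𝒮.
Isolated : Subset n → Family n → Set
Isolated S 𝒮 = cardID 𝒮 + cardID (S ∷ []) ≡ suc (cardID (S ∷ 𝒮))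

isolated-⊥ : (S : Subset n) (𝒮 : Family n) → Isolated ⊥ (S ∷ 𝒮)
isolated-⊥ {n} S 𝒮 = begin
  cardID (S ∷ 𝒮) + cardID {n} (⊥ ∷ []) ≡⟨ cong (cardID (S ∷ 𝒮) +_) (cardID-⊥ {n}) ⟩
  cardID (S ∷ 𝒮) + 1                   ≡⟨ +-comm _ 1 ⟩
  suc (cardID (S ∷ 𝒮))                 ≡⟨ cong suc (sym (cardID-redundant 𝒮 ⊥⊆)) ⟩
  suc (cardID (⊥ ∷ S ∷ 𝒮))             ∎
  where open ≡-Reasoning

grow : Subset n → Subset (2 + n)
grow S = inside ∷ outside ∷ S

growAll : Family n → Family (2 + n)
growAll 𝒮 = map (outside ∷_) (map (inside ∷_) 𝒮)

length-growAll : (𝒮 : Family n) → length (growAll 𝒮) ≡ length 𝒮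
length-growAll 𝒮 = trans (length-map (outside ∷_) (map (inside ∷_) 𝒮)) (length-map (inside ∷_) 𝒮)

cardID-grow : (S : Subset n) (𝒮 : Family n) → Isolated S 𝒮 →
              cardID (grow S ∷ growAll 𝒮) ≡ suc (2 * cardID (S ∷ 𝒮))
cardID-grow S 𝒮 isolated = begin
  cardID (grow S ∷ growAll 𝒮)
    ≡⟨ cardID-inside∷map-outside (outside ∷ S) (map (inside ∷_) 𝒮) ⟩
  cardID ((outside ∷ S) ∷ map (inside ∷_) 𝒮) + cardID ((outside ∷ S) ∷ [])
    ≡⟨ cong₂ _+_ (cardID-outside∷map-inside S 𝒮) (cardID-map-outside (S ∷ [])) ⟩
  cardID (S ∷ 𝒮) + cardID 𝒮 + cardID (S ∷ [])
    ≡⟨ +-assoc (cardID (S ∷ 𝒮)) _ _ ⟩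
  cardID (S ∷ 𝒮) + (cardID 𝒮 + cardID (S ∷ []))
    ≡⟨ cong (cardID (S ∷ 𝒮) +_) isolated ⟩
  cardID (S ∷ 𝒮) + suc (cardID (S ∷ 𝒮))
    ≡⟨ m+1+m≡1+2*m (cardID (S ∷ 𝒮)) ⟩
  suc (2 * cardID (S ∷ 𝒮))  ∎
  where
  open ≡-Reasoning
  m+1+m≡1+2*m : ∀ m → m + suc m ≡ suc (2 * m)
  m+1+m≡1+2*m = solve-∀

isolated-grow : (S : Subset n) (𝒮 : Family n) → Isolated S 𝒮 → Isolated (grow S) (growAll 𝒮)
isolated-grow S 𝒮 isolated = begin
  cardID (growAll 𝒮) + cardID (grow S ∷ [])
    ≡⟨ cong₂ _+_ (cardID-map-outside (map (inside ∷_) 𝒮)) (cardID-cone ((outside ∷ S) ∷ [])) ⟩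
  cardID (map (inside ∷_) 𝒮) + 2 * cardID ((outside ∷ S) ∷ [])
    ≡⟨ cong₂ (λ a b → a + 2 * b) (cardID-cone 𝒮) (cardID-map-outside (S ∷ [])) ⟩
  2 * cardID 𝒮 + 2 * cardID (S ∷ [])
    ≡⟨ *-distribˡ-+ 2 (cardID 𝒮) _ ⟨
  2 * (cardID 𝒮 + cardID (S ∷ []))
    ≡⟨ cong (2 *_) isolated ⟩
  2 * suc (cardID (S ∷ 𝒮))
    ≡⟨ *-suc 2 (cardID (S ∷ 𝒮)) ⟩
  suc (suc (2 * cardID (S ∷ 𝒮)))
    ≡⟨ cong suc (cardID-grow S 𝒮 isolated) ⟨
  suc (cardID (grow S ∷ growAll 𝒮))  ∎
  where open ≡-Reasoning

topOfRun?-suc : ∀ k i → topOfRun? k (suc i) ≡ topOfRun? (k / 2) i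
topOfRun?-suc k i with bit (k / 2) i ≟ 1 | bit (k / 2) (suc i) ≟ 0
... | yes _ | yes _ = refl
... | yes _ | no _  = refl
... | no _  | _     = refl

topOfRun?-true : ∀ {k i} → bit k i ≡ 1 → bit k (suc i) ≡ 0 → topOfRun? k i ≡ true
topOfRun?-true {k} {i} bit≡1 next≡0 with bit k i ≟ 1 | bit k (suc i) ≟ 0
... | yes _ | yes _      = refl
... | yes _ | no next≢0  = contradiction next≡0 next≢0
... | no bit≢1 | _       = contradiction bit≡1 bit≢1

topOfRun?-bit≡0 : ∀ {k i} → bit k i ≡ 0 → topOfRun? k i ≡ false
topOfRun?-bit≡0 {k} {i} bit≡0 with bit k i ≟ 1 | bit k (suc i) ≟ 0
... | yes bit≡1 | _ = contradiction (trans (sym bit≡0) bit≡1) λ ()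
... | no _      | _ = refl

topOfRun?-next≡1 : ∀ {k i} → bit k (suc i) ≡ 1 → topOfRun? k i ≡ false
topOfRun?-next≡1 {k} {i} next≡1 with bit k i ≟ 1 | bit k (suc i) ≟ 0
... | yes _ | yes next≡0 = contradiction (trans (sym next≡0) next≡1) λ ()
... | yes _ | no _       = refl
... | no _  | _          = refl

bit-≥ : ∀ {k i} → k ≤ i → bit k i ≡ 0
bit-≥ {i = zero} z≤n = refl
bit-≥ {zero} {suc i} _ = bit-≥ {i = i} z≤n
bit-≥ {suc k} {suc i} (s≤s k≤i) = bit-≥ (≤-trans (s≤s⁻¹ (m/n<m (suc k) 2 (s≤s (s≤s z≤n)))) k≤i)

applyUpTo-cong : {f g : ℕ → A} → (∀ i → f i ≡ g i) → ∀ j → applyUpTo f j ≡ applyUpTo g j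
applyUpTo-cong f≗g zero = refl
applyUpTo-cong f≗g (suc j) = cong₂ _∷_ (f≗g 0) (applyUpTo-cong (f≗g ∘ suc) j)

countTrue-applyUpTo-stable : ∀ {f m j} → (∀ {i} → m ≤ i → f i ≡ false) → m ≤ j →
                             countTrue (applyUpTo f j) ≡ countTrue (applyUpTo f m)
countTrue-applyUpTo-stable {m = zero} {zero} _ _ = refl
countTrue-applyUpTo-stable {f} {zero} {suc j} vanish _ rewrite vanish {0} z≤n =
  countTrue-applyUpTo-stable {f ∘ suc} {j = j} (λ _ → vanish z≤n) z≤n
countTrue-applyUpTo-stable {f} {suc m} {suc j} vanish (s≤s m≤j) with f 0
... | true  = cong suc (countTrue-applyUpTo-stable {f ∘ suc} {j = j} (vanish ∘ s≤s) m≤j)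
... | false = countTrue-applyUpTo-stable {f ∘ suc} {j = j} (vanish ∘ s≤s) m≤j

bl-unfold : ∀ k → bl k ≡ (if topOfRun? k 0 then suc (bl (k / 2)) else bl (k / 2))
bl-unfold zero = refl
bl-unfold (suc k) = begin
  countTrue (map (topOfRun? (suc k)) (upTo (suc k)))
    ≡⟨ cong countTrue (map-upTo (topOfRun? (suc k)) (suc k)) ⟩
  countTrue (topOfRun? (suc k) 0 ∷ applyUpTo (topOfRun? (suc k) ∘ suc) k)
    ≡⟨ cong (λ bs → countTrue (topOfRun? (suc k) 0 ∷ bs)) (applyUpTo-cong (topOfRun?-suc (suc k)) k) ⟩
  countTrue (topOfRun? (suc k) 0 ∷ applyUpTo (topOfRun? half) k)
    ≡⟨ countTrue-∷ (topOfRun? (suc k) 0) ⟩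
  (if topOfRun? (suc k) 0 then suc (countTrue (applyUpTo (topOfRun? half) k))
                          else countTrue (applyUpTo (topOfRun? half) k))
    ≡⟨ cong (λ c → if topOfRun? (suc k) 0 then suc c else c)
            (countTrue-applyUpTo-stable (topOfRun?-bit≡0 ∘ bit-≥) half≤k) ⟩
  (if topOfRun? (suc k) 0 then suc (countTrue (applyUpTo (topOfRun? half) half))
                          else countTrue (applyUpTo (topOfRun? half) half))
    ≡⟨ cong (λ c → if topOfRun? (suc k) 0 then suc c else c) (cong countTrue (map-upTo (topOfRun? half) half)) ⟨
  (if topOfRun? (suc k) 0 then suc (bl half) else bl half)  ∎
  where
  open ≡-Reasoning
  half = suc k / 2
  half≤k : half ≤ k
  half≤k = s≤s⁻¹ (m/n<m (suc k) 2 (s≤s (s≤s z≤n)))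
  countTrue-∷ : ∀ b {bs} → countTrue (b ∷ bs) ≡ (if b then suc (countTrue bs) else countTrue bs)
  countTrue-∷ true = refl
  countTrue-∷ false = refl

2*m%2≡0 : ∀ m → 2 * m % 2 ≡ 0
2*m%2≡0 m = trans (cong (_% 2) (*-comm 2 m)) (m*n%n≡0 m 2)

2*m/2≡m : ∀ m → 2 * m / 2 ≡ m
2*m/2≡m m = trans (cong (_/ 2) (*-comm 2 m)) (m*n/n≡m m 2)

[1+2*m]%2≡1 : ∀ m → suc (2 * m) % 2 ≡ 1
[1+2*m]%2≡1 m = trans (cong (λ x → suc x % 2) (*-comm 2 m)) ([m+kn]%n≡m%n 1 m 2)

[1+2*m]/2≡m : ∀ m → suc (2 * m) / 2 ≡ m
[1+2*m]/2≡m m = trans (+-distrib-/ 1 (2 * m) 1%2+2*m%2<2) (2*m/2≡m m)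
  where
  1%2+2*m%2<2 : 1 % 2 + 2 * m % 2 < 2
  1%2+2*m%2<2 = subst (λ r → 1 + r < 2) (sym (2*m%2≡0 m)) (s≤s (s≤s z≤n))

%2-parity : ∀ m → m % 2 ≡ 0 ⊎ m % 2 ≡ 1
%2-parity m with m % 2 | m%n<n m 2
... | 0 | _ = inj₁ refl
... | 1 | _ = inj₂ refl
... | suc (suc _) | s≤s (s≤s ())

bl-2*m : ∀ m → bl (2 * m) ≡ bl m
bl-2*m m rewrite bl-unfold (2 * m) | topOfRun?-bit≡0 {2 * m} {0} (2*m%2≡0 m) | 2*m/2≡m m = refl

bl-1+2*m-odd : ∀ m → m % 2 ≡ 1 → bl (suc (2 * m)) ≡ bl m
bl-1+2*m-odd m odd
  rewrite bl-unfold (suc (2 * m))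
        | topOfRun?-next≡1 {suc (2 * m)} {0} (trans (cong (_% 2) ([1+2*m]/2≡m m)) odd)
        | [1+2*m]/2≡m m
  = refl

bl-1+2*m-even : ∀ m → m % 2 ≡ 0 → bl (suc (2 * m)) ≡ suc (bl m)
bl-1+2*m-even m even
  rewrite bl-unfold (suc (2 * m))
        | topOfRun?-true {suc (2 * m)} {0} ([1+2*m]%2≡1 m) (trans (cong (_% 2) ([1+2*m]/2≡m m)) even)
        | [1+2*m]/2≡m m
  = refl

record Realisation (k : ℕ) : Set where
  field
    {ground}        : ℕ
    apex            : Subset ground
    rest            : Family ground
    length-rest     : length rest ≤ bl k
    cardID-family   : cardID (apex ∷ rest) ≡ k
    isolated-if-odd : k % 2 ≡ 1 → Isolated apex rest

realisation-1 : Realisation 1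
realisation-1 = record
  { apex = []
  ; rest = [] ∷ []
  ; length-rest = s≤s z≤n
  ; cardID-family = refl
  ; isolated-if-odd = λ _ → refl
  }

realisation-2*m : ∀ {m} → Realisation m → Realisation (2 * m)
realisation-2*m {m} r = record
  { apex = inside ∷ apex
  ; rest = map (inside ∷_) rest
  ; length-rest = subst (length (map (inside ∷_) rest) ≤_) (sym (bl-2*m m))
                        (≤-trans (≤-reflexive (length-map (inside ∷_) rest)) length-rest)
  ; cardID-family = trans (cardID-cone (apex ∷ rest)) (cong (2 *_) cardID-family)
  ; isolated-if-odd = λ odd → contradiction (trans (sym (2*m%2≡0 m)) odd) λ ()
  }
  where open Realisation r

realisation-1+2*m : ∀ {m} → Realisation m → Realisation (suc (2 * m))
realisation-1+2*m {m} r with %2-parity m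
... | inj₂ odd = record
  { apex = grow apex
  ; rest = growAll rest
  ; length-rest = subst (length (growAll rest) ≤_) (sym (bl-1+2*m-odd m odd))
                        (≤-trans (≤-reflexive (length-growAll rest)) length-rest)
  ; cardID-family = trans (cardID-grow apex rest (isolated-if-odd odd)) (cong (suc ∘ (2 *_)) cardID-family)
  ; isolated-if-odd = λ _ → isolated-grow apex rest (isolated-if-odd odd)
  }
  where open Realisation r
... | inj₁ even = record
  { apex = grow ⊥
  ; rest = growAll (apex ∷ rest)
  ; length-rest = subst (length (growAll (apex ∷ rest)) ≤_) (sym (bl-1+2*m-even m even))
                        (≤-trans (≤-reflexive (length-growAll (apex ∷ rest))) (s≤s length-rest))
  ; cardID-family = trans (cardID-grow ⊥ (apex ∷ rest) (isolated-⊥ apex rest))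
                          (cong (suc ∘ (2 *_)) (trans (cardID-redundant rest ⊥⊆) cardID-family))
  ; isolated-if-odd = λ _ → isolated-grow ⊥ (apex ∷ rest) (isolated-⊥ apex rest)
  }
  where open Realisation r

realisation : (x : ℕᵇ) → Realisation (suc (Bin.toℕ x))
realisation Bin.zero = realisation-1
realisation 2[1+ x ] = realisation-1+2*m (realisation x)
realisation 1+[2 x ] = subst Realisation (*-suc 2 (Bin.toℕ x)) (realisation-2*m (realisation x))

lemma20 : (k : ℕ) → 1 ≤ k →
    Σ ℕ λ n → Σ (Family n) λ 𝒮 → (length 𝒮 ≤ bl k + 1) × (cardID 𝒮 ≡ k)
lemma20 (suc k) _ =
  ground , apex ∷ rest , subst (suc (length rest) ≤_) (+-comm 1 (bl (suc k))) (s≤s length-rest) , cardID-family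
  where open Realisation (subst Realisation (cong suc (toℕ-fromℕ k)) (realisation (Bin.fromℕ k)))
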